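{- Let $n \geq 2$ be an integer and let $T$ be a tree with maximal $F$-index among all molecular trees with $n$ vertices. Then: (a) If $(n-2) \bmod 3 = 0$, then $T$ contains $\frac{n-2}{3}$ vertices of degree $4$ and $\frac{2n+2}{3}$ vertices of degree $1$ (and no other vertices), and $F(T) = 22n - 42$. (b) Otherwise, $T$ contains $\frac{n-1-x}{3}$ vertices of degree $4$, $\frac{2(n-1)+x}{3}$ vertices of degree $1$, and one vertex of degree $x$ (and no other vertices), where $x$ is the unique integer with $2 \leq x \leq 3$ and $(n-1-x) \bmod 3 = 0$; and $F(T) = 22(n-1) - 21x + x^3$.
   Context: A molecular tree is a tree in which every vertex has degree at most $4$. For a graph $G$ with vertex set $V(G)$, $d(v)$ denotes the degree of a vertex $v$, and the $F$-index (forgotten topological index) of $G$ is $F(G)=\sum_{v\in V(G)} d(v)^3$. -}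

module Defs where

open import Data.Bool using (Bool; true; false; if_then_else_)
open import Data.Nat using (ℕ; _≤_; _≟_)
open import Data.Fin using (Fin)
open import Data.List using (List; []; _∷_; _++_; take; length; map; filter; allFin)
open import Data.Nat.ListAction using (sum)
open import Data.List.Relation.Unary.Unique.Propositional using (Unique)
open import Data.Product using (Σ; _×_)
open import Relation.Binary.PropositionalEquality using (_≡_)
open import Relation.Nullary using (¬_)

record Graph (n : ℕ) : Set where
  field
    adj   : Fin n → Fin n → Bool
    sym   : ∀ i j → adj i j ≡ adj j i
    irref : ∀ i → adj i i ≡ false
open Graph public

Adj : ∀ {n} → Graph n → Fin n → Fin n → Set
Adj G i j = adj G i j ≡ true

deg : ∀ {n} → Graph n → Fin n → ℕ
deg {n} G i = sum (map (λ j → if adj G i j then 1 else 0) (allFin n))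

countDeg : ∀ {n} → Graph n → ℕ → ℕ
countDeg {n} G d = length (filter (λ i → deg G i ≟ d) (allFin n))

Findex : ∀ {n} → Graph n → ℕ
Findex {n} G = sum (map (λ i → deg G i Data.Nat.^ 3) (allFin n))

data Walk {n} (G : Graph n) : Fin n → Fin n → Set where
  here : ∀ v → Walk G v v
  step : ∀ {u v w} → Adj G u v → Walk G v w → Walk G u w

Connected : ∀ {n} → Graph n → Set
Connected G = ∀ i j → Walk G i j

data Chain {n} (G : Graph n) : List (Fin n) → Set where
  single : ∀ v → Chain G (v ∷ [])
  cons   : ∀ {v w vs} → Adj G v w → Chain G (w ∷ vs) → Chain G (v ∷ w ∷ vs)

IsCycle : ∀ {n} → Graph n → List (Fin n) → Set
IsCycle G vs = (3 ≤ length vs) × Unique vs × Chain G (vs ++ take 1 vs)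

Acyclic : ∀ {n} → Graph n → Set
Acyclic {n} G = ¬ (Σ (List (Fin n)) (IsCycle G))

IsTree : ∀ {n} → Graph n → Set
IsTree G = Connected G × Acyclic G

IsMolecularTree : ∀ {n} → Graph n → Set
IsMolecularTree G = IsTree G × (∀ v → deg G v ≤ 4)

IsFMaxMolecularTree : ∀ {n} → Graph n → Set
IsFMaxMolecularTree {n} T =
  IsMolecularTree T × ((T' : Graph n) → IsMolecularTree T' → Findex T' ≤ Findex T)

-- Count the vertices of a molecular tree by degree as c₁, …, c₄. A forest on n vertices has degree
-- sum at most 2n − 2, so c₁ = 2 + c₃ + 2c₄ + D with D ≥ 0, and substituting into n = Σ cᵢ and
-- F = Σ i³cᵢ gives 22n − F = 42 + 14c₂ + 16c₃ + 21D. Caterpillars, grown by attaching leaves to one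
-- hub until it has degree 4 and then moving on to the newest leaf, reach 22n − F = 42 + g with
-- g = 0, 14, 16 according as n − 2 ≡ 0, 1, 2 (mod 3). So an F-maximal tree has
-- 14c₂ + 16c₃ + 21D ≤ g ≤ 16: D = 0 and at most one vertex has degree 2 or 3, and then the residue of
-- n = 2 + (c₂ + 2c₃) + 3c₄ modulo 3 determines c₂, c₃ and c₄.
module Submission where

open import Defs hiding (sym)
open import Data.Bool as Bool using (Bool; true; false; if_then_else_)
open import Data.Empty using (⊥-elim)
open import Data.Fin as Fin using (Fin; zero; suc; punchIn)
open import Data.Fin.Properties using (punchInᵢ≢i; punchIn-injective; pigeonhole)
import Data.Fin.Properties as Fin
open import Data.Integer using (+_) renaming (_+_ to _+ℤ_; _-_ to _-ℤ_; _*_ to _*ℤ_; _%ℕ_ to _%ℤ_)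
open import Data.Integer.Properties using (pos-+; pos-*)
import Data.Integer.Tactic.RingSolver as ℤ
open import Data.List as List using (List; []; _∷_; _++_; take; length; map; filter; allFin; lookup)
open import Data.List.Properties using (map-tabulate; length-map; map-++; ++-assoc; length-++; ++-identityʳ)
open import Data.List.Membership.Propositional using (_∈_; _∉_)
open import Data.List.Membership.Propositional.Properties using (∈-∃++)
open import Data.List.Relation.Unary.All using (All; []; _∷_; head)
import Data.List.Relation.Unary.All as All
open import Data.List.Relation.Unary.All.Properties using (¬Any⇒All¬; ++⁻ˡ; ++⁻ʳ)
open import Data.List.Relation.Unary.AllPairs using ([]; _∷_)
open import Data.List.Relation.Unary.Any using (here; there; any?)
open import Data.List.Relation.Unary.Unique.Propositional using (Unique)
import Data.List.Relation.Unary.Unique.Propositional.Properties as Unique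
open import Data.Nat using (ℕ; zero; suc; _+_; _*_; _^_; _∸_; _/_; _%_; _≤_; _<_; z≤n; s≤s; _≤?_; _≟_)
open import Data.Nat.DivMod using (m*n/n≡m; m*n%n≡0; [m+kn]%n≡m%n; m<n⇒m%n≡m)
open import Data.Nat.ListAction using () renaming (sum to listSum)
open import Data.Nat.Properties
open import Data.Nat.Tactic.RingSolver using (solve-∀)
open import Data.Product using (∃; _×_; _,_; proj₁; proj₂)
open import Data.Sum using (_⊎_; inj₁; inj₂)
open import Function using (_∘_; id)
open import Relation.Binary.PropositionalEquality
open import Relation.Nullary using (¬_; yes; no; does; _×-dec_; ¬?)
open import Relation.Nullary.Decidable using (dec-true; dec-false)
open import Relation.Unary using (Decidable)

open import Algebra.Properties.Semiring.Sum +-*-semiring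
  using (sum; sum-syntax; sum-remove; ∑-distrib-+; *-distribˡ-sum; sum-cong-≗; sum-replicate-zero)

𝟙 : Bool → ℕ
𝟙 b = if b then 1 else 0

sum-tabulate : ∀ {n} (f : Fin n → ℕ) → listSum (List.tabulate f) ≡ sum f
sum-tabulate {zero}  f = refl
sum-tabulate {suc n} f = cong (_+_ (f zero)) (sum-tabulate (f ∘ suc))

sum-map-allFin : ∀ {n} (f : Fin n → ℕ) → listSum (map f (allFin n)) ≡ sum f
sum-map-allFin {n} f = trans (cong listSum (map-tabulate id f)) (sum-tabulate f)

≤-sum : ∀ {n} (f : Fin n → ℕ) i → f i ≤ sum f
≤-sum {suc n} f i = subst (f i ≤_) (sym (sum-remove {i = i} f)) (m≤m+n (f i) _)

sum-mono-≤ : ∀ {n} {f g : Fin n → ℕ} → (∀ i → f i ≤ g i) → sum f ≤ sum g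
sum-mono-≤ {zero}  f≤g = z≤n
sum-mono-≤ {suc n} f≤g = +-mono-≤ (f≤g zero) (sum-mono-≤ (f≤g ∘ suc))

∑-1 : ∀ n → ∑[ i < n ] 1 ≡ n
∑-1 zero    = refl
∑-1 (suc n) = cong suc (∑-1 n)

∑-𝟙-≟ : ∀ {n} (a : Fin n) → ∑[ j < n ] 𝟙 (does (j Fin.≟ a)) ≡ 1
∑-𝟙-≟ {suc n} a = begin
  ∑[ j < suc n ] 𝟙 (does (j Fin.≟ a))
    ≡⟨ sum-remove {i = a} (λ j → 𝟙 (does (j Fin.≟ a))) ⟩
  𝟙 (does (a Fin.≟ a)) + ∑[ j < n ] 𝟙 (does (punchIn a j Fin.≟ a))
    ≡⟨ cong₂ _+_ (cong 𝟙 (dec-true (a Fin.≟ a) refl))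
                 (sum-cong-≗ (λ j → cong 𝟙 (dec-false (punchIn a j Fin.≟ a) (punchInᵢ≢i a j)))) ⟩
  1 + ∑[ j < n ] 0
    ≡⟨ cong suc (sum-replicate-zero n) ⟩
  1 ∎
  where open ≡-Reasoning

degree : ∀ {n} → Graph n → Fin n → ℕ
degree {n} G i = ∑[ j < n ] 𝟙 (adj G i j)

deg≡degree : ∀ {n} (G : Graph n) i → deg G i ≡ degree G i
deg≡degree G i = sum-map-allFin (λ j → 𝟙 (adj G i j))

degreeSum : ∀ {n} → Graph n → ℕ
degreeSum G = sum (degree G)

Adj-sym : ∀ {n} (G : Graph n) {i j} → Adj G i j → Adj G j i
Adj-sym G {i} {j} i~j = trans (Graph.sym G j i) i~j

Adj⇒≢ : ∀ {n} (G : Graph n) {i j} → Adj G i j → i ≢ j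
Adj⇒≢ G {i} i~i refl with trans (sym i~i) (irref G i)
... | ()

Adj⇒1≤degree : ∀ {n} (G : Graph n) {i j} → Adj G i j → 1 ≤ degree G i
Adj⇒1≤degree G {i} {j} i~j = subst (λ b → 𝟙 b ≤ degree G i) i~j (≤-sum _ j)

Walk⇒1≤deg : ∀ {n} {G : Graph n} {i j} → Walk G i j → i ≢ j → 1 ≤ deg G i
Walk⇒1≤deg (here _) i≢i = ⊥-elim (i≢i refl)
Walk⇒1≤deg {G = G} {i} (step i~v _) _ = subst (1 ≤_) (sym (deg≡degree G i)) (Adj⇒1≤degree G i~v)

Connected⇒1≤deg : ∀ {n} (G : Graph (suc (suc n))) → Connected G → ∀ v → 1 ≤ deg G v
Connected⇒1≤deg G connected zero    = Walk⇒1≤deg (connected zero (suc zero)) (λ ())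
Connected⇒1≤deg G connected (suc v) = Walk⇒1≤deg (connected (suc v) zero) (λ ())

-- Forests

removeVertex : ∀ {n} → Graph (suc n) → Fin (suc n) → Graph n
removeVertex G v = record
  { adj   = λ i j → adj G (punchIn v i) (punchIn v j)
  ; sym   = λ i j → Graph.sym G (punchIn v i) (punchIn v j)
  ; irref = λ i → irref G (punchIn v i)
  }

degreeSum-removeVertex : ∀ {n} (G : Graph (suc n)) v →
  degreeSum G ≡ 2 * degree G v + degreeSum (removeVertex G v)
degreeSum-removeVertex {n} G v = begin
  degreeSum G
    ≡⟨ sum-remove {i = v} (degree G) ⟩
  d + ∑[ i < n ] degree G (punchIn v i)
    ≡⟨ cong (_+_ d) (sum-cong-≗ (λ i → sum-remove {i = v} (λ j → 𝟙 (adj G (punchIn v i) j)))) ⟩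
  d + ∑[ i < n ] (𝟙 (adj G (punchIn v i) v) + degree G-v i)
    ≡⟨ cong (_+_ d) (∑-distrib-+ (λ i → 𝟙 (adj G (punchIn v i) v)) (degree G-v)) ⟩
  d + (∑[ i < n ] 𝟙 (adj G (punchIn v i) v) + degreeSum G-v)
    ≡⟨ cong (λ e → d + (e + degreeSum G-v)) edges-at-v ⟩
  d + (d + degreeSum G-v)
    ≡⟨ sym (+-assoc d d (degreeSum G-v)) ⟩
  d + d + degreeSum G-v
    ≡⟨ cong (λ e → d + e + degreeSum G-v) (sym (+-identityʳ d)) ⟩
  2 * d + degreeSum G-v ∎
  where
  open ≡-Reasoning
  d = degree G v
  G-v = removeVertex G v
  edges-at-v : ∑[ i < n ] 𝟙 (adj G (punchIn v i) v) ≡ d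
  edges-at-v = begin
    ∑[ i < n ] 𝟙 (adj G (punchIn v i) v)
      ≡⟨ sum-cong-≗ (λ i → cong 𝟙 (Graph.sym G (punchIn v i) v)) ⟩
    ∑[ i < n ] 𝟙 (adj G v (punchIn v i))
      ≡⟨ cong (λ b → 𝟙 b + ∑[ i < n ] 𝟙 (adj G v (punchIn v i))) (sym (irref G v)) ⟩
    𝟙 (adj G v v) + ∑[ i < n ] 𝟙 (adj G v (punchIn v i))
      ≡⟨ sym (sum-remove {i = v} (λ j → 𝟙 (adj G v j))) ⟩
    d ∎

Chain-map : ∀ {m n} {H : Graph m} {G : Graph n} (f : Fin m → Fin n) →
  (∀ {i j} → Adj H i j → Adj G (f i) (f j)) → ∀ {xs} → Chain H xs → Chain G (map f xs)
Chain-map f hom (single v) = single (f v)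
Chain-map f hom (cons a c) = cons (hom a) (Chain-map f hom c)

map-closeUp : ∀ {A B : Set} (f : A → B) (xs : List A) →
  map f (xs ++ take 1 xs) ≡ map f xs ++ take 1 (map f xs)
map-closeUp f []       = refl
map-closeUp f (x ∷ xs) = cong (f x ∷_) (map-++ f xs (x ∷ []))

Acyclic-embedding : ∀ {m n} {H : Graph m} {G : Graph n} (f : Fin m → Fin n) →
  (∀ {i j} → f i ≡ f j → i ≡ j) → (∀ {i j} → Adj H i j → Adj G (f i) (f j)) →
  Acyclic G → Acyclic H
Acyclic-embedding {G = G} f inj hom acyclic (cs , 3≤len , unique , chain) =
  acyclic (map f cs , subst (3 ≤_) (sym (length-map f cs)) 3≤len , Unique.map⁺ inj unique ,
           subst (Chain G) (map-closeUp f cs) (Chain-map f hom chain))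

removeVertex-acyclic : ∀ {n} (G : Graph (suc n)) v → Acyclic G → Acyclic (removeVertex G v)
removeVertex-acyclic G v = Acyclic-embedding (punchIn v) (punchIn-injective v _ _) (λ a → a)

Chain-++⁻ˡ : ∀ {n} {G : Graph n} x xs ys → Chain G ((x ∷ xs) ++ ys) → Chain G (x ∷ xs)
Chain-++⁻ˡ x []        ys c          = single x
Chain-++⁻ˡ x (x′ ∷ xs) ys (cons a c) = cons a (Chain-++⁻ˡ x′ xs ys c)

Chain-∷ʳ : ∀ {n} {G : Graph n} xs a b → Chain G (xs ++ a ∷ []) → Adj G a b → Chain G (xs ++ a ∷ b ∷ [])
Chain-∷ʳ []             a b c          a~b = cons a~b (single b)
Chain-∷ʳ (x ∷ [])       a b (cons p c) a~b = cons p (cons a~b (single b))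
Chain-∷ʳ (x ∷ x′ ∷ xs)  a b (cons p c) a~b = cons p (Chain-∷ʳ (x′ ∷ xs) a b c a~b)

Chain-last : ∀ {n} {G : Graph n} xs a b → Chain G (xs ++ a ∷ b ∷ []) → Adj G a b
Chain-last []            a b (cons a~b _) = a~b
Chain-last (x ∷ [])      a b (cons _ c)   = Chain-last [] a b c
Chain-last (x ∷ x′ ∷ xs) a b (cons _ c)   = Chain-last (x′ ∷ xs) a b c

Unique-++⁻ˡ : ∀ {A : Set} (xs : List A) {ys} → Unique (xs ++ ys) → Unique xs
Unique-++⁻ˡ []       u          = []
Unique-++⁻ˡ (x ∷ xs) (x∉ ∷ u) = ++⁻ˡ xs x∉ ∷ Unique-++⁻ˡ xs u

All-lookup : ∀ {A : Set} {P : A → Set} {xs : List A} → All P xs → (i : Fin (length xs)) → P (lookup xs i)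
All-lookup (px ∷ _)   zero    = px
All-lookup (_  ∷ pxs) (suc i) = All-lookup pxs i

Unique-lookup : ∀ {A : Set} {xs : List A} → Unique xs → ∀ {i j : Fin (length xs)} →
  i Fin.< j → lookup xs i ≢ lookup xs j
Unique-lookup (x∉ ∷ u) {zero}  {suc j} _       = All-lookup x∉ j
Unique-lookup (x∉ ∷ u) {suc i} {suc j} (s≤s p) = Unique-lookup u p

Unique-length≤ : ∀ {n} {xs : List (Fin n)} → Unique xs → length xs ≤ n
Unique-length≤ {n} {xs} u with length xs ≤? n
... | yes len≤n = len≤n
... | no  len≰n with pigeonhole (≰⇒> len≰n) (lookup xs)
...   | i , j , i<j , eq = ⊥-elim (Unique-lookup u i<j eq)

another-neighbour : ∀ {n} (G : Graph n) → (∀ v → 2 ≤ degree G v) → ∀ v w → ∃ λ u → Adj G v u × u ≢ w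
another-neighbour {n} G 2≤deg v w
  with Fin.any? (λ u → (adj G v u Bool.≟ true) ×-dec ¬? (u Fin.≟ w))
... | yes found = found
... | no  none  = ⊥-elim (<⇒≱ (2≤deg v) (≤-trans (sum-mono-≤ only-w) (≤-reflexive (∑-𝟙-≟ w))))
  where
  only-w : ∀ u → 𝟙 (adj G v u) ≤ 𝟙 (does (u Fin.≟ w))
  only-w u with adj G v u in v~u
  ... | false = z≤n
  ... | true with u Fin.≟ w
  ...   | yes _   = ≤-refl
  ...   | no  u≢w = ⊥-elim (none (u , v~u , u≢w))

-- With minimum degree 2 and no cycles, every path can be prolonged at its head; long paths then
-- contradict the pigeonhole principle, which yields a leaf.
module _ {n} (G : Graph n) (2≤deg : ∀ v → 2 ≤ degree G v) (acyclic : Acyclic G) where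

  Path : List (Fin n) → Set
  Path xs = Unique xs × Chain G xs

  path-of-length : Fin n → ∀ k → ∃ λ x → ∃ λ y → ∃ λ rest → Path (x ∷ y ∷ rest) × length rest ≡ k
  path-of-length v zero with another-neighbour G 2≤deg v v
  ... | u , v~u , _ =
    u , v , [] , (((λ u≡v → Adj⇒≢ G v~u (sym u≡v)) ∷ []) ∷ [] ∷ [] , cons (Adj-sym G v~u) (single v)) , refl
  path-of-length v (suc k) with path-of-length v k
  ... | x , y , rest , (unique , chain) , len with another-neighbour G 2≤deg x y
  ...   | u , x~u , u≢y with any? (u Fin.≟_) (x ∷ y ∷ rest)
  ...     | no u∉ = u , x , y ∷ rest , (¬Any⇒All¬ _ u∉ ∷ unique , cons (Adj-sym G x~u) chain) , cong suc len
  ...     | yes (here u≡x)          = ⊥-elim (Adj⇒≢ G x~u (sym u≡x))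
  ...     | yes (there (here u≡y))  = ⊥-elim (u≢y u≡y)
  ...     | yes (there (there u∈))  with ∈-∃++ u∈
  ...       | pre , post , refl = ⊥-elim (acyclic (x ∷ y ∷ pre ++ u ∷ [] , 3≤len , cycle-unique , cycle-chain))
    where
    split : (x ∷ y ∷ pre ++ u ∷ []) ++ post ≡ x ∷ y ∷ pre ++ u ∷ post
    split = cong (λ t → x ∷ y ∷ t) (++-assoc pre (u ∷ []) post)
    3≤len : 3 ≤ length (x ∷ y ∷ pre ++ u ∷ [])
    3≤len = s≤s (s≤s (subst (1 ≤_) (sym (length-++ pre)) (m≤n+m 1 (length pre))))
    cycle-unique : Unique (x ∷ y ∷ pre ++ u ∷ [])
    cycle-unique = Unique-++⁻ˡ (x ∷ y ∷ pre ++ u ∷ []) (subst Unique (sym split) unique)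
    cycle-chain : Chain G ((x ∷ y ∷ pre ++ u ∷ []) ++ x ∷ [])
    cycle-chain = subst (Chain G) (cong (λ t → x ∷ y ∷ t) (sym (++-assoc pre (u ∷ []) (x ∷ []))))
      (Chain-∷ʳ (x ∷ y ∷ pre) u x (Chain-++⁻ˡ x (y ∷ pre ++ u ∷ []) post (subst (Chain G) (sym split) chain))
                (Adj-sym G x~u))

leaf-exists : ∀ {n} (G : Graph (suc n)) → Acyclic G → ∃ λ v → degree G v ≤ 1
leaf-exists {n} G acyclic with Fin.any? (λ v → degree G v ≤? 1)
... | yes leaf = leaf
... | no  none with path-of-length G (λ v → ≰⇒> (λ v≤1 → none (v , v≤1))) acyclic zero (suc n)
...   | x , y , rest , (unique , _) , len =
  ⊥-elim (<⇒≱ (s≤s (s≤s (≤-trans (n≤1+n n) (≤-reflexive (sym len))))) (Unique-length≤ unique))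

Acyclic⇒degreeSum≤ : ∀ {n} (G : Graph (suc n)) → Acyclic G → degreeSum G ≤ 2 * n
Acyclic⇒degreeSum≤ {zero} G _ = ≤-reflexive (cong (λ b → 𝟙 b + 0 + 0) (irref G zero))
Acyclic⇒degreeSum≤ {suc n} G acyclic with leaf-exists G acyclic
... | v , deg≤1 = begin
  degreeSum G                                  ≡⟨ degreeSum-removeVertex G v ⟩
  2 * degree G v + degreeSum (removeVertex G v) ≤⟨ +-mono-≤ (*-monoʳ-≤ 2 deg≤1)
       (Acyclic⇒degreeSum≤ (removeVertex G v) (removeVertex-acyclic G v acyclic)) ⟩
  2 * 1 + 2 * n                                ≡⟨ sym (*-distribˡ-+ 2 1 n) ⟩
  2 * suc n                                    ∎
  where open ≤-Reasoning

-- Attaching a leaf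

Walk-++ : ∀ {n} {G : Graph n} {i j k} → Walk G i j → Walk G j k → Walk G i k
Walk-++ (here _)   w′ = w′
Walk-++ (step a w) w′ = step a (Walk-++ w w′)

addLeaf : ∀ {k} → Graph k → Fin k → Graph (suc k)
addLeaf {k} H a = record { adj = adj′ ; sym = sym′ ; irref = irref′ }
  where
  adj′ : Fin (suc k) → Fin (suc k) → Bool
  adj′ zero    zero    = false
  adj′ zero    (suc j) = does (j Fin.≟ a)
  adj′ (suc i) zero    = does (i Fin.≟ a)
  adj′ (suc i) (suc j) = adj H i j
  sym′ : ∀ i j → adj′ i j ≡ adj′ j i
  sym′ zero    zero    = refl
  sym′ zero    (suc j) = refl
  sym′ (suc i) zero    = refl
  sym′ (suc i) (suc j) = Graph.sym H i j
  irref′ : ∀ i → adj′ i i ≡ false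
  irref′ zero    = refl
  irref′ (suc i) = irref H i

Walk-lift : ∀ {k} {H : Graph k} {a i j} → Walk H i j → Walk (addLeaf H a) (suc i) (suc j)
Walk-lift (here v)   = here (suc v)
Walk-lift (step p w) = step p (Walk-lift w)

addLeaf-connected : ∀ {k} (H : Graph k) a → Connected H → Connected (addLeaf H a)
addLeaf-connected H a connected zero    zero    = here zero
addLeaf-connected H a connected zero    (suc j) = step (dec-true (a Fin.≟ a) refl) (Walk-lift (connected a j))
addLeaf-connected H a connected (suc i) zero    =
  Walk-++ (Walk-lift (connected i a)) (step (dec-true (a Fin.≟ a) refl) (here zero))
addLeaf-connected H a connected (suc i) (suc j) = Walk-lift (connected i j)

addLeaf-neighbour : ∀ {k} {H : Graph k} {a y} → Adj (addLeaf H a) zero y → y ≡ suc a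
addLeaf-neighbour {a = a} {suc j} 0~y with j Fin.≟ a
... | yes j≡a = cong suc j≡a

IsCycle-rotate₁ : ∀ {n} {G : Graph n} x xs → IsCycle G (x ∷ xs) → IsCycle G (xs ++ x ∷ [])
IsCycle-rotate₁ {G = G} x (y ∷ ys) (s≤s 3≤len , x∉ ∷ unique , cons x~y chain) =
  subst (3 ≤_) (sym (trans (length-++ (y ∷ ys)) (+-comm (length (y ∷ ys)) 1))) (s≤s 3≤len) ,
  Unique.++⁺ unique ([] ∷ []) disjoint ,
  subst (Chain G) (sym (++-assoc (y ∷ ys) (x ∷ []) (y ∷ []))) (Chain-∷ʳ (y ∷ ys) x y chain x~y)
  where
  disjoint : ∀ {v} → ¬ (v ∈ y ∷ ys × v ∈ x ∷ [])
  disjoint (v∈ , here refl) = All.lookup x∉ v∈ refl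
IsCycle-rotate₁ x [] (s≤s () , _)

IsCycle-rotate : ∀ {n} {G : Graph n} pre z post → IsCycle G (pre ++ z ∷ post) → IsCycle G (z ∷ post ++ pre)
IsCycle-rotate {G = G} []        z post c = subst (IsCycle G) (cong (z ∷_) (sym (++-identityʳ post))) c
IsCycle-rotate {G = G} (p ∷ pre) z post c =
  subst (IsCycle G) (cong (z ∷_) (++-assoc post (p ∷ []) pre))
    (IsCycle-rotate pre z (post ++ p ∷ [])
      (subst (IsCycle G) (++-assoc pre (z ∷ post) (p ∷ [])) (IsCycle-rotate₁ p (pre ++ z ∷ post) c)))

IsCycle⇒two-neighbours : ∀ {n} {G : Graph n} z xs → IsCycle G (z ∷ xs) →
  ∃ λ y → ∃ λ w → Adj G z y × Adj G w z × y ≢ w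
IsCycle⇒two-neighbours {G = G} z (y ∷ ys) (3≤len , unique , cons z~y chain) with List.initLast ys
IsCycle⇒two-neighbours z (y ∷ .[]) (s≤s (s≤s ()) , _) | []
IsCycle⇒two-neighbours {G = G} z (y ∷ .(ini List.∷ʳ w)) (_ , (_ ∷ y∉ ∷ _) , cons z~y chain) | ini List.∷ʳ′ w =
  y , w , z~y , Chain-last (z ∷ y ∷ ini) w z (subst (Chain G) reassoc (cons z~y chain)) , head (++⁻ʳ ini y∉)
  where
  reassoc : z ∷ y ∷ (ini ++ w ∷ []) ++ z ∷ [] ≡ (z ∷ y ∷ ini) ++ w ∷ z ∷ []
  reassoc = cong (λ t → z ∷ y ∷ t) (++-assoc ini (w ∷ []) (z ∷ []))
IsCycle⇒two-neighbours z [] (s≤s () , _)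

∉⇒map-suc : ∀ {k} (cs : List (Fin (suc k))) → zero ∉ cs → ∃ λ ys → cs ≡ map suc ys
∉⇒map-suc []           _   = [] , refl
∉⇒map-suc (zero ∷ cs)  0∉ = ⊥-elim (0∉ (here refl))
∉⇒map-suc (suc y ∷ cs) 0∉ with ∉⇒map-suc cs (0∉ ∘ there)
... | ys , refl = y ∷ ys , refl

Chain-unlift : ∀ {k} {H : Graph k} {a} {zs} → Chain (addLeaf H a) zs → ∀ ys → zs ≡ map suc ys → Chain H ys
Chain-unlift (single v) (y ∷ [])      refl = single y
Chain-unlift (cons p c) (y ∷ y′ ∷ ys) refl = cons p (Chain-unlift c (y′ ∷ ys) refl)

-- A cycle cannot pass through the new leaf, which has a single neighbour; any other cycle lies in H.
addLeaf-acyclic : ∀ {k} (H : Graph k) a → Acyclic H → Acyclic (addLeaf H a)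
addLeaf-acyclic H a acyclic (cs , cycle) with any? (zero Fin.≟_) cs
... | yes 0∈ with ∈-∃++ 0∈
...   | pre , post , refl with IsCycle⇒two-neighbours zero (post ++ pre) (IsCycle-rotate pre zero post cycle)
...     | y , w , 0~y , w~0 , y≢w =
  y≢w (trans (addLeaf-neighbour {H = H} 0~y) (sym (addLeaf-neighbour {H = H} (Adj-sym (addLeaf H a) {w} {zero} w~0))))
addLeaf-acyclic H a acyclic (cs , 3≤len , unique , chain) | no 0∉ with ∉⇒map-suc cs 0∉
... | ys , refl = acyclic (ys , subst (3 ≤_) (length-map suc ys) 3≤len , Unique.map⁻ unique ,
                           Chain-unlift chain (ys ++ take 1 ys) (sym (map-closeUp suc ys)))

module _ {k} (H : Graph k) (a : Fin k) where

  deg-addLeaf-leaf : deg (addLeaf H a) zero ≡ 1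
  deg-addLeaf-leaf = trans (deg≡degree (addLeaf H a) zero) (∑-𝟙-≟ a)

  deg-addLeaf-old : ∀ i → deg (addLeaf H a) (suc i) ≡ 𝟙 (does (i Fin.≟ a)) + deg H i
  deg-addLeaf-old i =
    trans (deg≡degree (addLeaf H a) (suc i)) (cong (_+_ (𝟙 (does (i Fin.≟ a)))) (sym (deg≡degree H i)))

Findex≡∑ : ∀ {n} (G : Graph n) → Findex G ≡ ∑[ i < n ] (deg G i ^ 3)
Findex≡∑ G = sum-map-allFin (λ i → deg G i ^ 3)

Findex-addLeaf : ∀ {k} (H : Graph k) a → Findex (addLeaf H a) + deg H a ^ 3 ≡ Findex H + 1 + suc (deg H a) ^ 3
Findex-addLeaf {suc k} H a = begin
  Findex H′ + d ^ 3            ≡⟨ cong (_+ d ^ 3) Findex-H′ ⟩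
  1 + (suc d ^ 3 + R) + d ^ 3  ≡⟨ rearrange (d ^ 3) (suc d ^ 3) R ⟩
  d ^ 3 + R + 1 + suc d ^ 3    ≡⟨ cong (λ x → x + 1 + suc d ^ 3) (sym Findex-H) ⟩
  Findex H + 1 + suc d ^ 3     ∎
  where
  open ≡-Reasoning
  H′ = addLeaf H a
  d = deg H a
  R = ∑[ i < k ] (deg H (punchIn a i) ^ 3)
  rearrange : ∀ x y z → 1 + (y + z) + x ≡ x + z + 1 + y
  rearrange = solve-∀
  Findex-H : Findex H ≡ d ^ 3 + R
  Findex-H = trans (Findex≡∑ H) (sum-remove {i = a} (λ i → deg H i ^ 3))
  Findex-H′ : Findex H′ ≡ 1 + (suc d ^ 3 + R)
  Findex-H′ = begin
    Findex H′
      ≡⟨ Findex≡∑ H′ ⟩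
    deg H′ zero ^ 3 + ∑[ i < suc k ] (deg H′ (suc i) ^ 3)
      ≡⟨ cong₂ _+_ (cong (_^ 3) (deg-addLeaf-leaf H a)) (sum-cong-≗ (λ i → cong (_^ 3) (deg-addLeaf-old H a i))) ⟩
    1 + ∑[ i < suc k ] ((𝟙 (does (i Fin.≟ a)) + deg H i) ^ 3)
      ≡⟨ cong suc (sum-remove {i = a} (λ i → (𝟙 (does (i Fin.≟ a)) + deg H i) ^ 3)) ⟩
    1 + ((𝟙 (does (a Fin.≟ a)) + d) ^ 3 + ∑[ i < k ] ((𝟙 (does (punchIn a i Fin.≟ a)) + deg H (punchIn a i)) ^ 3))
      ≡⟨ cong suc (cong₂ _+_ (cong (λ b → (𝟙 b + d) ^ 3) (dec-true (a Fin.≟ a) refl))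
                                 (sum-cong-≗ λ i → cong (λ b → (𝟙 b + deg H (punchIn a i)) ^ 3)
                                                         (dec-false (punchIn a i Fin.≟ a) (punchInᵢ≢i a i)))) ⟩
    1 + (suc d ^ 3 + R) ∎

addLeaf-molecular : ∀ {k} (H : Graph k) a → IsMolecularTree H → suc (deg H a) ≤ 4 → IsMolecularTree (addLeaf H a)
addLeaf-molecular H a ((connected , acyclic) , bounded) room =
  (addLeaf-connected H a connected , addLeaf-acyclic H a acyclic) , bounded′
  where
  bounded′ : ∀ v → deg (addLeaf H a) v ≤ 4
  bounded′ zero = subst (_≤ 4) (sym (deg-addLeaf-leaf H a)) (s≤s z≤n)
  bounded′ (suc i) with i Fin.≟ a | deg-addLeaf-old H a i
  ... | yes refl | deg≡ = subst (_≤ 4) (sym deg≡) room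
  ... | no  _    | deg≡ = subst (_≤ 4) (sym deg≡) (bounded i)

-- Caterpillars

-- The deficit 22n − 42 − F of the extremal trees on n ≡ r + 2 (mod 3) vertices.
gap : ℕ → ℕ
gap 0 = 0
gap 1 = 14
gap _ = 16

record Caterpillar (n r : ℕ) : Set where
  field
    tree      : Graph n
    molecular : IsMolecularTree tree
    hub       : Fin n
    hub-deg   : deg tree hub ≡ suc r
    Findex-eq : Findex tree + 42 + gap r ≡ 22 * n

Findex-step : ∀ {F F′ x y g g′} n → 1 + y + g′ ≡ x + 22 + g → F′ + x ≡ F + 1 + y →
  F + 42 + g ≡ 22 * n → F′ + 42 + g′ ≡ 22 * suc n
Findex-step {F} {F′} {x} {y} {g} {g′} n gaps F′-eq F-eq = +-cancelʳ-≡ x _ _ (begin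
  F′ + 42 + g′ + x      ≡⟨ shuffle₁ F′ x g′ ⟩
  F′ + x + 42 + g′      ≡⟨ cong (λ t → t + 42 + g′) F′-eq ⟩
  F + 1 + y + 42 + g′   ≡⟨ shuffle₂ F y g′ ⟩
  F + 42 + (1 + y + g′) ≡⟨ cong (_+_ (F + 42)) gaps ⟩
  F + 42 + (x + 22 + g) ≡⟨ shuffle₃ F x g ⟩
  F + 42 + g + 22 + x   ≡⟨ cong (λ t → t + 22 + x) F-eq ⟩
  22 * n + 22 + x       ≡⟨ cong (_+ x) (sym (trans (*-suc 22 n) (+-comm 22 (22 * n)))) ⟩
  22 * suc n + x        ∎)
  where
  open ≡-Reasoning
  shuffle₁ : ∀ a b c → a + 42 + c + b ≡ a + b + 42 + c
  shuffle₁ = solve-∀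
  shuffle₂ : ∀ a b c → a + 1 + b + 42 + c ≡ a + 42 + (1 + b + c)
  shuffle₂ = solve-∀
  shuffle₃ : ∀ a b c → a + 42 + (b + 22 + c) ≡ a + 42 + c + 22 + b
  shuffle₃ = solve-∀

extend : ∀ {n r r′} (C : Caterpillar n r) → let open Caterpillar C in
  suc (suc r) ≤ 4 → 1 + suc (suc r) ^ 3 + gap r′ ≡ suc r ^ 3 + 22 + gap r →
  (hub′ : Fin (suc n)) → deg (addLeaf tree hub) hub′ ≡ suc r′ → Caterpillar (suc n) r′
extend {n} {r} {r′} C room gaps hub′ hub′-deg = record
  { tree      = addLeaf tree hub
  ; molecular = addLeaf-molecular tree hub molecular (subst (λ d → suc d ≤ 4) (sym hub-deg) room)
  ; hub       = hub′
  ; hub-deg   = hub′-deg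
  ; Findex-eq = Findex-step {Findex tree} {Findex (addLeaf tree hub)} n
                  (subst (λ d → 1 + suc d ^ 3 + gap r′ ≡ d ^ 3 + 22 + gap r) (sym hub-deg) gaps)
                  (Findex-addLeaf tree hub) Findex-eq
  }
  where open Caterpillar C

grow : ∀ {n r} → Caterpillar n r → suc (suc r) ≤ 4 → 1 + suc (suc r) ^ 3 + gap (suc r) ≡ suc r ^ 3 + 22 + gap r →
  Caterpillar (suc n) (suc r)
grow {r = r} C room gaps = extend C room gaps (suc hub) (begin
  deg (addLeaf tree hub) (suc hub)        ≡⟨ deg-addLeaf-old tree hub hub ⟩
  𝟙 (does (hub Fin.≟ hub)) + deg tree hub ≡⟨ cong (λ b → 𝟙 b + deg tree hub) (dec-true (hub Fin.≟ hub) refl) ⟩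
  suc (deg tree hub)                      ≡⟨ cong suc hub-deg ⟩
  suc (suc r)                             ∎)
  where
  open Caterpillar C
  open ≡-Reasoning

restart : ∀ {n} → Caterpillar n 2 → Caterpillar (suc n) 0
restart C = extend C ≤-refl refl zero (deg-addLeaf-leaf (Caterpillar.tree C) (Caterpillar.hub C))

K₁ : Graph 1
K₁ = record { adj = λ _ _ → false ; sym = λ _ _ → refl ; irref = λ _ → refl }

K₁-molecular : IsMolecularTree K₁
K₁-molecular = (connected , acyclic) , λ { zero → z≤n }
  where
  connected : Connected K₁
  connected zero zero = here zero
  acyclic : Acyclic K₁
  acyclic (cs , 3≤len , unique , _) with ≤-trans 3≤len (Unique-length≤ unique)
  ... | s≤s ()

caterpillar₀ : ∀ q → Caterpillar (2 + q * 3) 0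
caterpillar₁ : ∀ q → Caterpillar (3 + q * 3) 1
caterpillar₂ : ∀ q → Caterpillar (4 + q * 3) 2

caterpillar₀ zero = record
  { tree      = addLeaf K₁ zero
  ; molecular = addLeaf-molecular K₁ zero K₁-molecular (s≤s z≤n)
  ; hub       = zero
  ; hub-deg   = deg-addLeaf-leaf K₁ zero
  ; Findex-eq = refl
  }
caterpillar₀ (suc q) = restart (caterpillar₂ q)
caterpillar₁ q = grow (caterpillar₀ q) (s≤s (s≤s z≤n)) refl
caterpillar₂ q = grow (caterpillar₁ q) (s≤s (s≤s (s≤s z≤n))) refl

count : ∀ {n} → (Fin n → ℕ) → ℕ → ℕ
count {n} f d = ∑[ i < n ] 𝟙 (does (f i ≟ d))

length-filter≡∑ : ∀ {A : Set} {P : A → Set} (P? : Decidable P) xs →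
  length (filter P? xs) ≡ listSum (map (𝟙 ∘ does ∘ P?) xs)
length-filter≡∑ P? []       = refl
length-filter≡∑ P? (x ∷ xs) with does (P? x)
... | true  = cong suc (length-filter≡∑ P? xs)
... | false = length-filter≡∑ P? xs

countDeg≡count : ∀ {n} (G : Graph n) d → countDeg G d ≡ count (deg G) d
countDeg≡count {n} G d =
  trans (length-filter≡∑ (λ i → deg G i ≟ d) (allFin n)) (sum-map-allFin (λ i → 𝟙 (does (deg G i ≟ d))))

count≡0⇒≢ : ∀ {n} (f : Fin n → ℕ) d → count f d ≡ 0 → ∀ v → f v ≢ d
count≡0⇒≢ f d none v refl = 1+n≰n (begin
  1                            ≡⟨ cong 𝟙 (sym (dec-true (f v ≟ f v) refl)) ⟩
  𝟙 (does (f v ≟ f v))         ≤⟨ ≤-sum (λ i → 𝟙 (does (f i ≟ f v))) v ⟩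
  count f (f v)                ≡⟨ none ⟩
  0                            ∎)
  where open ≤-Reasoning

countDeg≡0⇒≢ : ∀ {n} (G : Graph n) d → countDeg G d ≡ 0 → ∀ v → deg G v ≢ d
countDeg≡0⇒≢ G d none = count≡0⇒≢ (deg G) d (trans (sym (countDeg≡count G d)) none)

value-split : ∀ (h : ℕ → ℕ) d → 1 ≤ d → d ≤ 4 →
  h d ≡ h 1 * 𝟙 (does (d ≟ 1)) + h 2 * 𝟙 (does (d ≟ 2)) + h 3 * 𝟙 (does (d ≟ 3)) + h 4 * 𝟙 (does (d ≟ 4))
value-split h 1 _ _ = select₁ (h 1) (h 2) (h 3) (h 4)
  where select₁ : ∀ a b c d → a ≡ a * 1 + b * 0 + c * 0 + d * 0
        select₁ = solve-∀
value-split h 2 _ _ = select₂ (h 1) (h 2) (h 3) (h 4)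
  where select₂ : ∀ a b c d → b ≡ a * 0 + b * 1 + c * 0 + d * 0
        select₂ = solve-∀
value-split h 3 _ _ = select₃ (h 1) (h 2) (h 3) (h 4)
  where select₃ : ∀ a b c d → c ≡ a * 0 + b * 0 + c * 1 + d * 0
        select₃ = solve-∀
value-split h 4 _ _ = select₄ (h 1) (h 2) (h 3) (h 4)
  where select₄ : ∀ a b c d → d ≡ a * 0 + b * 0 + c * 0 + d * 1
        select₄ = solve-∀
value-split h (suc (suc (suc (suc (suc _))))) _ (s≤s (s≤s (s≤s (s≤s ()))))

∑-by-value : ∀ {n} (f : Fin n → ℕ) → (∀ i → 1 ≤ f i) → (∀ i → f i ≤ 4) → ∀ (h : ℕ → ℕ) →
  ∑[ i < n ] h (f i) ≡ h 1 * count f 1 + h 2 * count f 2 + h 3 * count f 3 + h 4 * count f 4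
∑-by-value {n} f 1≤f f≤4 h = begin
  ∑[ i < n ] h (f i)
    ≡⟨ sum-cong-≗ (λ i → value-split h (f i) (1≤f i) (f≤4 i)) ⟩
  ∑[ i < n ] (w 1 i + w 2 i + w 3 i + w 4 i)
    ≡⟨ ∑-distrib-+ (λ i → w 1 i + w 2 i + w 3 i) (w 4) ⟩
  ∑[ i < n ] (w 1 i + w 2 i + w 3 i) + sum (w 4)
    ≡⟨ cong (_+ sum (w 4)) (∑-distrib-+ (λ i → w 1 i + w 2 i) (w 3)) ⟩
  ∑[ i < n ] (w 1 i + w 2 i) + sum (w 3) + sum (w 4)
    ≡⟨ cong (λ x → x + sum (w 3) + sum (w 4)) (∑-distrib-+ (w 1) (w 2)) ⟩
  sum (w 1) + sum (w 2) + sum (w 3) + sum (w 4)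
    ≡⟨ sym (cong₂ _+_ (cong₂ _+_ (cong₂ _+_ (*-distribˡ-sum (h 1) (c 1)) (*-distribˡ-sum (h 2) (c 2)))
                                   (*-distribˡ-sum (h 3) (c 3)))
                       (*-distribˡ-sum (h 4) (c 4))) ⟩
  h 1 * count f 1 + h 2 * count f 2 + h 3 * count f 3 + h 4 * count f 4 ∎
  where
  open ≡-Reasoning
  c : ℕ → Fin n → ℕ
  c d i = 𝟙 (does (f i ≟ d))
  w : ℕ → Fin n → ℕ
  w d i = h d * c d i

degree-slack : ∀ c₁ c₂ c₃ c₄ {m} → suc m ≡ c₁ + c₂ + c₃ + c₄ → 1 * c₁ + 2 * c₂ + 3 * c₃ + 4 * c₄ ≤ 2 * m →
  ∃ λ D → c₁ ≡ 2 + c₃ + 2 * c₄ + D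
degree-slack c₁ c₂ c₃ c₄ {m} count-eq sum≤ with m≤n⇒∃[o]m+o≡n sum≤
... | D , sum+D≡2m = D , +-cancelˡ-≡ X c₁ (2 + c₃ + 2 * c₄ + D) (begin
  X + c₁                                    ≡⟨ double c₁ c₂ c₃ c₄ ⟩
  2 * (c₁ + c₂ + c₃ + c₄)                   ≡⟨ cong (2 *_) (sym count-eq) ⟩
  2 * suc m                                 ≡⟨ *-suc 2 m ⟩
  2 + 2 * m                                 ≡⟨ cong (_+_ 2) (sym sum+D≡2m) ⟩
  2 + (1 * c₁ + 2 * c₂ + 3 * c₃ + 4 * c₄ + D) ≡⟨ regroup c₁ c₂ c₃ c₄ D ⟩
  X + (2 + c₃ + 2 * c₄ + D)                 ∎)
  where
  open ≡-Reasoning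
  X = c₁ + 2 * c₂ + 2 * c₃ + 2 * c₄
  double : ∀ a b x y → a + 2 * b + 2 * x + 2 * y + a ≡ 2 * (a + b + x + y)
  double = solve-∀
  regroup : ∀ a b x y e → 2 + (1 * a + 2 * b + 3 * x + 4 * y + e) ≡ a + 2 * b + 2 * x + 2 * y + (2 + x + 2 * y + e)
  regroup = solve-∀

module _ {k} (T : Graph (2 + k)) (molecular : IsMolecularTree T) where

  private
    c : ℕ → ℕ
    c = countDeg T

  ∑-deg-by-value : ∀ (h : ℕ → ℕ) → ∑[ i < 2 + k ] h (deg T i) ≡ h 1 * c 1 + h 2 * c 2 + h 3 * c 3 + h 4 * c 4
  ∑-deg-by-value h = begin
    ∑[ i < 2 + k ] h (deg T i)
      ≡⟨ ∑-by-value (deg T) (Connected⇒1≤deg T (proj₁ (proj₁ molecular))) (proj₂ molecular) h ⟩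
    h 1 * count (deg T) 1 + h 2 * count (deg T) 2 + h 3 * count (deg T) 3 + h 4 * count (deg T) 4
      ≡⟨ sym (cong₂ _+_ (cong₂ _+_ (cong₂ _+_ (cong (h 1 *_) (countDeg≡count T 1))
                                              (cong (h 2 *_) (countDeg≡count T 2)))
                                   (cong (h 3 *_) (countDeg≡count T 3)))
                        (cong (h 4 *_) (countDeg≡count T 4))) ⟩
    h 1 * c 1 + h 2 * c 2 + h 3 * c 3 + h 4 * c 4 ∎
    where open ≡-Reasoning

  vertex-count : 2 + k ≡ c 1 + c 2 + c 3 + c 4
  vertex-count = trans (sym (∑-1 (2 + k))) (trans (∑-deg-by-value (λ _ → 1)) (unit-weights (c 1) (c 2) (c 3) (c 4)))
    where unit-weights : ∀ a b x y → 1 * a + 1 * b + 1 * x + 1 * y ≡ a + b + x + y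
          unit-weights = solve-∀

  Findex-by-degree : Findex T ≡ c 1 + 8 * c 2 + 27 * c 3 + 64 * c 4
  Findex-by-degree = trans (Findex≡∑ T) (trans (∑-deg-by-value (_^ 3))
    (cong (λ x → x + 8 * c 2 + 27 * c 3 + 64 * c 4) (*-identityˡ (c 1))))

  leaf-count : ∃ λ D → c 1 ≡ 2 + c 3 + 2 * c 4 + D
  leaf-count = degree-slack (c 1) (c 2) (c 3) (c 4) vertex-count (begin
    1 * c 1 + 2 * c 2 + 3 * c 3 + 4 * c 4 ≡⟨ sym (∑-deg-by-value (λ d → d)) ⟩
    ∑[ i < 2 + k ] deg T i               ≡⟨ sum-cong-≗ (deg≡degree T) ⟩
    degreeSum T                          ≤⟨ Acyclic⇒degreeSum≤ T (proj₂ (proj₁ molecular)) ⟩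
    2 * suc k                            ∎)
    where open ≤-Reasoning

classify : ∀ {k} (T : Graph (2 + k)) → IsMolecularTree T → ∀ v →
  deg T v ≡ 1 ⊎ deg T v ≡ 2 ⊎ deg T v ≡ 3 ⊎ deg T v ≡ 4
classify T ((connected , _) , bounded) v = cases (deg T v) (Connected⇒1≤deg T connected v) (bounded v)
  where
  cases : ∀ d → 1 ≤ d → d ≤ 4 → d ≡ 1 ⊎ d ≡ 2 ⊎ d ≡ 3 ⊎ d ≡ 4
  cases 1 _ _ = inj₁ refl
  cases 2 _ _ = inj₂ (inj₁ refl)
  cases 3 _ _ = inj₂ (inj₂ (inj₁ refl))
  cases 4 _ _ = inj₂ (inj₂ (inj₂ refl))
  cases (suc (suc (suc (suc (suc _))))) _ (s≤s (s≤s (s≤s (s≤s ()))))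

degrees-among : ∀ {k} (T : Graph (2 + k)) → IsMolecularTree T → (P : ℕ → Set) → P 1 → P 4 →
  countDeg T 2 ≡ 0 ⊎ P 2 → countDeg T 3 ≡ 0 ⊎ P 3 → ∀ v → P (deg T v)
degrees-among T molecular P P1 P4 P2 P3 v with classify T molecular v
... | inj₁ d≡1                 = subst P (sym d≡1) P1
... | inj₂ (inj₂ (inj₂ d≡4))   = subst P (sym d≡4) P4
... | inj₂ (inj₁ d≡2)          with P2
...   | inj₁ none = ⊥-elim (countDeg≡0⇒≢ T 2 none v d≡2)
...   | inj₂ p    = subst P (sym d≡2) p
degrees-among T molecular P P1 P4 P2 P3 v | inj₂ (inj₂ (inj₁ d≡3)) with P3
...   | inj₁ none = ⊥-elim (countDeg≡0⇒≢ T 3 none v d≡3)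
...   | inj₂ p    = subst P (sym d≡3) p

-- The upper bound

defect-identity : ∀ {c₁} c₂ c₃ c₄ D → c₁ ≡ 2 + c₃ + 2 * c₄ + D →
  22 * (c₁ + c₂ + c₃ + c₄) ≡ c₁ + 8 * c₂ + 27 * c₃ + 64 * c₄ + 42 + (c₂ * 14 + c₃ * 16 + D * 21)
defect-identity c₂ c₃ c₄ D refl = identity c₂ c₃ c₄ D
  where
  identity : ∀ b x y e → 22 * (2 + x + 2 * y + e + b + x + y) ≡
    2 + x + 2 * y + e + 8 * b + 27 * x + 64 * y + 42 + (b * 14 + x * 16 + e * 21)
  identity = solve-∀

Findex+defect : ∀ {k} (T : Graph (2 + k)) → IsMolecularTree T → ∀ {D} →
  countDeg T 1 ≡ 2 + countDeg T 3 + 2 * countDeg T 4 + D →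
  Findex T + 42 + (countDeg T 2 * 14 + countDeg T 3 * 16 + D * 21) ≡ 22 * (2 + k)
Findex+defect {k} T molecular {D} c₁≡ = begin
  Findex T + 42 + defect                            ≡⟨ cong (λ F → F + 42 + defect) (Findex-by-degree T molecular) ⟩
  c 1 + 8 * c 2 + 27 * c 3 + 64 * c 4 + 42 + defect ≡⟨ sym (defect-identity (c 2) (c 3) (c 4) D c₁≡) ⟩
  22 * (c 1 + c 2 + c 3 + c 4)                      ≡⟨ cong (22 *_) (sym (vertex-count T molecular)) ⟩
  22 * (2 + k)                                      ∎
  where
  open ≡-Reasoning
  c = countDeg T
  defect = c 2 * 14 + c 3 * 16 + D * 21

F-maximal⇒defect≤gap : ∀ {k r} (T : Graph (2 + k)) → IsFMaxMolecularTree T → Caterpillar (2 + k) r → ∀ {D} →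
  countDeg T 1 ≡ 2 + countDeg T 3 + 2 * countDeg T 4 + D →
  countDeg T 2 * 14 + countDeg T 3 * 16 + D * 21 ≤ gap r
F-maximal⇒defect≤gap {k} {r} T (molecular , maximal) C c₁≡ = +-cancelˡ-≤ (Findex T + 42) _ _ (begin
  Findex T + 42 + _          ≡⟨ Findex+defect T molecular c₁≡ ⟩
  22 * (2 + k)               ≡⟨ sym Findex-eq ⟩
  Findex tree + 42 + gap r   ≤⟨ +-monoˡ-≤ (gap r) (+-monoˡ-≤ 42 (maximal tree molecular′)) ⟩
  Findex T + 42 + gap r      ∎)
  where
  open ≤-Reasoning
  open Caterpillar C renaming (molecular to molecular′)

-- The numbers of vertices of degree 2 and 3 in an F-maximal molecular tree on n ≡ r + 2 (mod 3) vertices.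
Profile : ℕ → ℕ → ℕ → Set
Profile 0 c₂ c₃ = c₂ ≡ 0 × c₃ ≡ 0
Profile 1 c₂ c₃ = c₂ ≡ 1 × c₃ ≡ 0
Profile _ c₂ c₃ = c₂ ≡ 0 × c₃ ≡ 1

gap≤16 : ∀ r → gap r ≤ 16
gap≤16 0             = z≤n
gap≤16 1             = m≤m+n 14 2
gap≤16 (suc (suc _)) = ≤-refl

17+m≰16 : ∀ {m} → ¬ (17 + m ≤ 16)
17+m≰16 {m} le = 1+n≰n (≤-trans (m≤m+n 17 m) le)

defect≤16 : ∀ c₂ c₃ D → c₂ * 14 + c₃ * 16 + D * 21 ≤ 16 →
  D ≡ 0 × c₂ + 2 * c₃ < 3 × Profile (c₂ + 2 * c₃) c₂ c₃
defect≤16 0 0 0 _ = refl , s≤s z≤n , refl , refl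
defect≤16 1 0 0 _ = refl , s≤s (s≤s z≤n) , refl , refl
defect≤16 0 1 0 _ = refl , ≤-refl , refl , refl
defect≤16 (suc (suc _)) _             _       le = ⊥-elim (17+m≰16 le)
defect≤16 0             (suc (suc _)) _       le = ⊥-elim (17+m≰16 le)
defect≤16 1             (suc (suc _)) _       le = ⊥-elim (17+m≰16 le)
defect≤16 1             1             _       le = ⊥-elim (17+m≰16 le)
defect≤16 0             0             (suc _) le = ⊥-elim (17+m≰16 le)
defect≤16 1             0             (suc _) le = ⊥-elim (17+m≰16 le)
defect≤16 0             1             (suc _) le = ⊥-elim (17+m≰16 le)

+-*3-injective : ∀ {r s a b} → r < 3 → s < 3 → r + a * 3 ≡ s + b * 3 → r ≡ s × a ≡ b
+-*3-injective {r} {s} {a} {b} r<3 s<3 eq =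
  r≡s , *-cancelʳ-≡ a b 3 (+-cancelˡ-≡ r _ _ (trans eq (cong (_+ b * 3) (sym r≡s))))
  where
  r≡s : r ≡ s
  r≡s = begin
    r                ≡⟨ sym (m<n⇒m%n≡m r<3) ⟩
    r % 3            ≡⟨ sym ([m+kn]%n≡m%n r a 3) ⟩
    (r + a * 3) % 3  ≡⟨ cong (_% 3) eq ⟩
    (s + b * 3) % 3  ≡⟨ [m+kn]%n≡m%n s b 3 ⟩
    s % 3            ≡⟨ m<n⇒m%n≡m s<3 ⟩
    s                ∎
    where open ≡-Reasoning

private
  vertex-count-regroup : ∀ b x y → 2 + (b + 2 * x + y * 3) ≡ 2 + x + 2 * y + 0 + b + x + y
  vertex-count-regroup = solve-∀

degree-profile : ∀ {q r c₁ c₂ c₃ c₄ D} → r < 3 → 2 + r + q * 3 ≡ c₁ + c₂ + c₃ + c₄ →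
  c₁ ≡ 2 + c₃ + 2 * c₄ + D → c₂ * 14 + c₃ * 16 + D * 21 ≤ gap r →
  D ≡ 0 × Profile r c₂ c₃ × c₄ ≡ q × c₁ ≡ 2 + c₃ + 2 * q
degree-profile {q} {r} {c₂ = c₂} {c₃} {c₄} {D} r<3 count-eq refl defect≤gap
  with defect≤16 c₂ c₃ D (≤-trans defect≤gap (gap≤16 r))
... | refl , s<3 , profile
  with +-*3-injective {a = c₄} {b = q} s<3 r<3
         (+-cancelˡ-≡ 2 _ _ (trans (vertex-count-regroup c₂ c₃ c₄) (sym count-eq)))
...   | refl , refl = refl , profile , refl , +-identityʳ (2 + c₃ + 2 * q)

Profile⇒defect≡gap : ∀ {r c₂ c₃} → r < 3 → Profile r c₂ c₃ → c₂ * 14 + c₃ * 16 + 0 * 21 ≡ gap r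
Profile⇒defect≡gap {0} _ (refl , refl) = refl
Profile⇒defect≡gap {1} _ (refl , refl) = refl
Profile⇒defect≡gap {2} _ (refl , refl) = refl
Profile⇒defect≡gap {suc (suc (suc _))} (s≤s (s≤s (s≤s ()))) _

record Extremal {n} (T : Graph n) (r q : ℕ) : Set where
  field
    profile   : Profile r (countDeg T 2) (countDeg T 3)
    count₄    : countDeg T 4 ≡ q
    count₁    : countDeg T 1 ≡ 2 + countDeg T 3 + 2 * q
    Findex-eq : Findex T + 42 + gap r ≡ 22 * n

F-maximal⇒extremal : ∀ {r q} (T : Graph (2 + r + q * 3)) → IsFMaxMolecularTree T → Caterpillar (2 + r + q * 3) r →
  r < 3 → Extremal T r q
F-maximal⇒extremal {r} {q} T maximal C r<3 = record
  { profile   = profile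
  ; count₄    = proj₁ (proj₂ (proj₂ result))
  ; count₁    = proj₂ (proj₂ (proj₂ result))
  ; Findex-eq = begin
      Findex T + 42 + gap r     ≡⟨ cong (λ d → Findex T + 42 + d) (sym defect≡gap) ⟩
      Findex T + 42 + defect D  ≡⟨ Findex+defect T molecular c₁≡ ⟩
      22 * (2 + r + q * 3)      ∎
  }
  where
  open ≡-Reasoning
  molecular = proj₁ maximal
  D = proj₁ (leaf-count T molecular)
  c₁≡ = proj₂ (leaf-count T molecular)
  defect : ℕ → ℕ
  defect d = countDeg T 2 * 14 + countDeg T 3 * 16 + d * 21
  result = degree-profile {q} {r} r<3 (vertex-count T molecular) c₁≡ (F-maximal⇒defect≤gap T maximal C c₁≡)
  profile = proj₁ (proj₂ result)
  defect≡gap : defect D ≡ gap r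
  defect≡gap = trans (cong defect (proj₁ result)) (Profile⇒defect≡gap r<3 profile)

ConclusionA : ∀ {n} → Graph n → Set
ConclusionA {n} T = (countDeg T 4 ≡ (n ∸ 2) / 3) × (countDeg T 1 ≡ (2 * n + 2) / 3)
  × (∀ v → deg T v ≡ 1 ⊎ deg T v ≡ 4)
  × (+ Findex T ≡ (+ 22 *ℤ + n) -ℤ + 42)

ConclusionB : ∀ {n} → Graph n → ℕ → Set
ConclusionB {n} T x = (countDeg T 4 ≡ (n ∸ 1 ∸ x) / 3) × (countDeg T 1 ≡ (2 * (n ∸ 1) + x) / 3)
  × (countDeg T x ≡ 1)
  × (∀ v → deg T v ≡ 1 ⊎ deg T v ≡ 4 ⊎ deg T v ≡ x)
  × (+ Findex T ≡ ((+ 22 *ℤ (+ n -ℤ + 1)) -ℤ (+ 21 *ℤ + x)) +ℤ + (x ^ 3))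

m≡n*3⇒m/3≡n : ∀ {m} a → m ≡ a * 3 → m / 3 ≡ a
m≡n*3⇒m/3≡n a refl = m*n/n≡m a 3

m+n≡o⇒+m≡+o-+n : ∀ {a b c} → a + b ≡ c → + a ≡ + c -ℤ + b
m+n≡o⇒+m≡+o-+n {a} {b} refl = sym (trans (cong (_-ℤ + b) (pos-+ a b)) (cancel (+ a) (+ b)))
  where cancel : ∀ i j → i +ℤ j -ℤ j ≡ i
        cancel = ℤ.solve-∀

-- For numerals g and x the first hypothesis is a ring identity, discharged by the solver at each use.
Findex-ℤ-formula : ∀ {F} m g x →
  (∀ i → + 22 *ℤ (+ 1 +ℤ i) -ℤ + (42 + g) ≡ ((+ 22 *ℤ i) -ℤ (+ 21 *ℤ + x)) +ℤ + (x ^ 3)) →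
  F + 42 + g ≡ 22 * suc m → + F ≡ ((+ 22 *ℤ + m) -ℤ (+ 21 *ℤ + x)) +ℤ + (x ^ 3)
Findex-ℤ-formula {F} m g x identity F-eq =
  trans (m+n≡o⇒+m≡+o-+n (trans (sym (+-assoc F 42 g)) F-eq))
        (trans (cong (_-ℤ + (42 + g)) (pos-* 22 (suc m))) (identity (+ m)))

count₁≡/3 : ∀ {c₁ c₃} q a m → c₁ ≡ 2 + c₃ + 2 * q → c₃ ≡ a → m ≡ (2 + a + 2 * q) * 3 → c₁ ≡ m / 3
count₁≡/3 q a m c₁≡ refl m≡ = trans c₁≡ (sym (m≡n*3⇒m/3≡n (2 + a + 2 * q) m≡))

private
  numerator₂ : ∀ q → 2 * (2 + q * 3) + 2 ≡ (2 + 0 + 2 * q) * 3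
  numerator₂ = solve-∀
  numerator₃ : ∀ q → 2 * (3 + q * 3) + 3 ≡ (2 + 1 + 2 * q) * 3
  numerator₃ = solve-∀

conclusionA : ∀ q (T : Graph (2 + q * 3)) → IsFMaxMolecularTree T → ConclusionA T
conclusionA q T maximal@(molecular , _) =
  trans count₄ (sym (m*n/n≡m q 3)) ,
  count₁≡/3 q 0 (2 * (2 + q * 3) + 2) count₁ (proj₂ profile) (numerator₂ q) ,
  degrees-among T molecular (λ d → d ≡ 1 ⊎ d ≡ 4) (inj₁ refl) (inj₂ refl)
                (inj₁ (proj₁ profile)) (inj₁ (proj₂ profile)) ,
  trans (m+n≡o⇒+m≡+o-+n (trans (sym (+-identityʳ _)) Findex-eq)) (cong (_-ℤ + 42) (pos-* 22 (2 + q * 3)))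
  where open Extremal (F-maximal⇒extremal {0} {q} T maximal (caterpillar₀ q) (s≤s z≤n))

conclusionB₁ : ∀ q (T : Graph (3 + q * 3)) → IsFMaxMolecularTree T → (x : ℕ) → 2 ≤ x → x ≤ 3 →
  ((+ (3 + q * 3) -ℤ + 1) -ℤ + x) %ℤ 3 ≡ 0 → ConclusionB T x
conclusionB₁ q T maximal@(molecular , _) 2 _ _ _ =
  trans count₄ (sym (m*n/n≡m q 3)) ,
  count₁≡/3 q 0 (2 * (2 + q * 3) + 2) count₁ (proj₂ profile) (numerator₂ q) ,
  proj₁ profile ,
  degrees-among T molecular (λ d → d ≡ 1 ⊎ d ≡ 4 ⊎ d ≡ 2) (inj₁ refl) (inj₂ (inj₁ refl))
                (inj₂ (inj₂ (inj₂ refl))) (inj₁ (proj₂ profile)) ,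
  Findex-ℤ-formula (2 + q * 3) 14 2 ℤ.solve-∀ Findex-eq
  where open Extremal (F-maximal⇒extremal {1} {q} T maximal (caterpillar₁ q) (s≤s (s≤s z≤n)))
-- Here n − 1 − x = −1, whose residue computes to 2.
conclusionB₁ zero    T maximal 3 _ _ ()
conclusionB₁ (suc q) T maximal 3 _ _ residue = ⊥-elim (1+n≢0 (trans (sym ([m+kn]%n≡m%n 2 q 3)) residue))
conclusionB₁ q T maximal 0                           () _ _
conclusionB₁ q T maximal 1                           (s≤s ()) _ _
conclusionB₁ q T maximal (suc (suc (suc (suc _)))) _ (s≤s (s≤s (s≤s ()))) _

conclusionB₂ : ∀ q (T : Graph (4 + q * 3)) → IsFMaxMolecularTree T → (x : ℕ) → 2 ≤ x → x ≤ 3 →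
  ((+ (4 + q * 3) -ℤ + 1) -ℤ + x) %ℤ 3 ≡ 0 → ConclusionB T x
conclusionB₂ q T maximal@(molecular , _) 3 _ _ _ =
  trans count₄ (sym (m*n/n≡m q 3)) ,
  count₁≡/3 q 1 (2 * (3 + q * 3) + 3) count₁ (proj₂ profile) (numerator₃ q) ,
  proj₂ profile ,
  degrees-among T molecular (λ d → d ≡ 1 ⊎ d ≡ 4 ⊎ d ≡ 3) (inj₁ refl) (inj₂ (inj₁ refl))
                (inj₁ (proj₁ profile)) (inj₂ (inj₂ (inj₂ refl))) ,
  Findex-ℤ-formula (3 + q * 3) 16 3 ℤ.solve-∀ Findex-eq
  where open Extremal (F-maximal⇒extremal {2} {q} T maximal (caterpillar₂ q) (s≤s (s≤s (s≤s z≤n))))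
conclusionB₂ q T maximal 2 _ _ residue = ⊥-elim (1+n≢0 (trans (sym ([m+kn]%n≡m%n 1 q 3)) residue))
conclusionB₂ q T maximal 0                           () _ _
conclusionB₂ q T maximal 1                           (s≤s ()) _ _
conclusionB₂ q T maximal (suc (suc (suc (suc _)))) _ (s≤s (s≤s (s≤s ()))) _

data Mod3 : ℕ → Set where
  residue₀ : ∀ q → Mod3 (q * 3)
  residue₁ : ∀ q → Mod3 (1 + q * 3)
  residue₂ : ∀ q → Mod3 (2 + q * 3)

mod3 : ∀ k → Mod3 k
mod3 zero = residue₀ 0
mod3 (suc k) with mod3 k
... | residue₀ q = residue₁ q
... | residue₁ q = residue₂ q
... | residue₂ q = residue₀ (suc q)

theorem2 : (n : ℕ) → 2 ≤ n → (T : Graph n) → IsFMaxMolecularTree T →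
    (((n ∸ 2) % 3 ≡ 0) →
      (countDeg T 4 ≡ (n ∸ 2) / 3) × (countDeg T 1 ≡ (2 * n + 2) / 3)
      × (∀ v → deg T v ≡ 1 ⊎ deg T v ≡ 4)
      × (+ Findex T ≡ (+ 22 *ℤ + n) -ℤ + 42))
    × (¬ ((n ∸ 2) % 3 ≡ 0) → (x : ℕ) → 2 ≤ x → x ≤ 3 →
      (((+ n -ℤ + 1) -ℤ + x) %ℤ 3 ≡ 0) →
      (countDeg T 4 ≡ (n ∸ 1 ∸ x) / 3) × (countDeg T 1 ≡ (2 * (n ∸ 1) + x) / 3)
      × (countDeg T x ≡ 1)
      × (∀ v → deg T v ≡ 1 ⊎ deg T v ≡ 4 ⊎ deg T v ≡ x)
      × (+ Findex T ≡ ((+ 22 *ℤ (+ n -ℤ + 1)) -ℤ (+ 21 *ℤ + x)) +ℤ + (x ^ 3)))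
theorem2 (suc (suc k)) (s≤s (s≤s z≤n)) T maximal with mod3 k
... | residue₀ q = (λ _ → conclusionA q T maximal) , (λ r≢0 → ⊥-elim (r≢0 (m*n%n≡0 q 3)))
... | residue₁ q = (λ r≡0 → ⊥-elim (1+n≢0 (trans (sym ([m+kn]%n≡m%n 1 q 3)) r≡0)))
                 , (λ _ → conclusionB₁ q T maximal)
... | residue₂ q = (λ r≡0 → ⊥-elim (1+n≢0 (trans (sym ([m+kn]%n≡m%n 2 q 3)) r≡0)))
                 , (λ _ → conclusionB₂ q T maximal)
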